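{- Let $t,\lambda$ be positive integers and let $D$ be a $(t,\lambda)$-liking digraph. Then for each integer $i$ with $1\le i<t$, every set of $t-i$ distinct vertices of $D$ has at least $\lambda+i$ common out-neighbors in $D$.
   Context: All digraphs are finite and have no loops and no multiple arcs. For positive integers $t,\lambda$, a digraph $D$ is a $(t,\lambda)$-liking digraph if every set of $t$ distinct vertices of $D$ has exactly $\lambda$ common out-neighbors (the definition presumes $D$ has at least $t$ vertices). -}

module Defs where

open import Data.Nat using (ℕ; _≤_)
open import Data.Bool using (Bool; true; false; _∧_; not; _∨_)
open import Data.Fin using (Fin)
open import Data.Fin.Subset using (Subset; ∣_∣)
open import Data.Vec using (tabulate; lookup)
open import Data.Vec.Functional using (foldr)
open import Data.Product using (_×_)
open import Relation.Binary.PropositionalEquality using (_≡_)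

-- A finite digraph on vertex set Fin n: arc u v = true iff there is an arc u → v.
-- No loops; no multiple arcs (arcs form a relation).
record Digraph (n : ℕ) : Set where
  field
    arc      : Fin n → Fin n → Bool
    loopless : ∀ v → arc v v ≡ false

open Digraph public

allFin : ∀ {n} → (Fin n → Bool) → Bool
allFin {n} p = foldr _∧_ true p

commonOut : ∀ {n} → Digraph n → Subset n → Subset n
commonOut D S = tabulate λ v → allFin λ u → not (lookup S u) ∨ arc D u v

IsLiking : ∀ {n} → ℕ → ℕ → Digraph n → Set
IsLiking {n} t l D =
  (t ≤ n) × (∀ (S : Subset n) → ∣ S ∣ ≡ t → ∣ commonOut D S ∣ ≡ l)

{-# OPTIONS --safe #-}
module Submission where

-- Downward induction on the size s of the vertex set.  If every (s+1)-set
-- has at least m ≥ 1 common out-neighbours and s < n, then an s-set S has a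
-- common out-neighbour w (inherited from any one-point extension of S), and
-- w ∉ S since D is loopless.  The common out-neighbours of the (s+1)-set
-- S ∪ {w} are common out-neighbours of S, and w is one of S's but not of
-- S ∪ {w}; so S has at least m + 1 of them.

open import Defs
open import Data.Bool using (Bool; true; false; not; _∨_)
open import Data.Bool.Properties using (∧-conicalˡ; ∧-conicalʳ)
open import Data.Empty using (⊥-elim)
open import Data.Fin using (Fin; zero; suc)
open import Data.Fin.Subset
  using (Subset; ∣_∣; _∈_; _∉_; _⊆_; _⊂_; _∪_; ⁅_⁆; ∁; Nonempty; inside; outside)
open import Data.Fin.Subset.Properties
  using ( nonempty?; Empty-unique; ∣⊥∣≡0; ∣∁p∣≡n∸∣p∣; x∈∁p⇒x∉p; x∈⁅x⁆
        ; p⊆p∪q; q⊆p∪q; ∪-identityʳ; p⊆q⇒∣p∣≤∣q∣; p⊂q⇒∣p∣<∣q∣ )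
open import Data.Nat using (ℕ; zero; suc; _+_; _∸_; _≤_; _<_; s≤s; z<s)
open import Data.Nat.Properties
  using ( ≤-trans; ≤-reflexive; <⇒≤; <⇒≱; m≤m+n; +-suc; +-identityʳ; m<n⇒0<n∸m
        ; +-∸-assoc; ∸-monoʳ-< )
open import Data.Product using (_,_; ∃; proj₁)
open import Data.Vec using (_∷_; lookup; here; there)
open import Data.Vec.Properties using (lookup∘tabulate; []=⇒lookup; lookup⇒[]=)
open import Relation.Nullary using (yes; no)
open import Relation.Binary.PropositionalEquality using (_≡_; refl; sym; trans; cong; subst)

private
  variable
    n : ℕ

allFin-true⁻ : (p : Fin n → Bool) → allFin p ≡ true → ∀ u → p u ≡ true
allFin-true⁻ {suc n} p all zero    = ∧-conicalˡ _ _ all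
allFin-true⁻ {suc n} p all (suc u) = allFin-true⁻ (λ x → p (suc x)) (∧-conicalʳ _ _ all) u

allFin-true⁺ : (p : Fin n → Bool) → (∀ u → p u ≡ true) → allFin p ≡ true
allFin-true⁺ {zero}  p h = refl
allFin-true⁺ {suc n} p h rewrite h zero = allFin-true⁺ (λ x → p (suc x)) (λ u → h (suc u))

∣p∪⁅x⁆∣≡1+∣p∣ : (p : Subset n) {x : Fin n} → x ∉ p → ∣ p ∪ ⁅ x ⁆ ∣ ≡ suc ∣ p ∣
∣p∪⁅x⁆∣≡1+∣p∣ (inside  ∷ p) {zero}  x∉p = ⊥-elim (x∉p here)
∣p∪⁅x⁆∣≡1+∣p∣ (outside ∷ p) {zero}  x∉p = cong (λ q → suc ∣ q ∣) (∪-identityʳ p)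
∣p∪⁅x⁆∣≡1+∣p∣ (inside  ∷ p) {suc x} x∉p = cong suc (∣p∪⁅x⁆∣≡1+∣p∣ p (λ x∈p → x∉p (there x∈p)))
∣p∪⁅x⁆∣≡1+∣p∣ (outside ∷ p) {suc x} x∉p = ∣p∪⁅x⁆∣≡1+∣p∣ p (λ x∈p → x∉p (there x∈p))

0<∣p∣⇒Nonempty : (p : Subset n) → 0 < ∣ p ∣ → Nonempty p
0<∣p∣⇒Nonempty {n} p 0<∣p∣ with nonempty? p
... | yes nonempty = nonempty
... | no  empty    = ⊥-elim (<⇒≱ 0<∣p∣ (≤-reflexive (trans (cong ∣_∣ (Empty-unique empty)) (∣⊥∣≡0 n))))

∣p∣<n⇒∃∉ : (p : Subset n) → ∣ p ∣ < n → ∃ λ x → x ∉ p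
∣p∣<n⇒∃∉ {n} p ∣p∣<n with 0<∣p∣⇒Nonempty (∁ p) (subst (0 <_) (sym (∣∁p∣≡n∸∣p∣ p)) (m<n⇒0<n∸m ∣p∣<n))
... | x , x∈∁p = x , x∈∁p⇒x∉p x∈∁p

module _ (D : Digraph n) where

  ∈commonOut⁻ : ∀ {S v} → v ∈ commonOut D S → ∀ {u} → u ∈ S → arc D u v ≡ true
  ∈commonOut⁻ {S} {v} v∈N {u} u∈S
    with allFin-true⁻ _ (trans (sym (lookup∘tabulate _ v)) ([]=⇒lookup v∈N)) u
  ... | arc∨ rewrite []=⇒lookup u∈S = arc∨

  ∈commonOut⁺ : ∀ {S v} → (∀ {u} → u ∈ S → arc D u v ≡ true) → v ∈ commonOut D S
  ∈commonOut⁺ {S} {v} arcs = lookup⇒[]= v _ (trans (lookup∘tabulate _ v) (allFin-true⁺ _ arc-if-in))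
    where
    arc-if-in : ∀ u → (not (lookup S u) ∨ arc D u v) ≡ true
    arc-if-in u with lookup S u in u∈?S
    ... | false = refl
    ... | true  = arcs (lookup⇒[]= u S u∈?S)

  commonOut-antimono : ∀ {S T} → S ⊆ T → commonOut D T ⊆ commonOut D S
  commonOut-antimono S⊆T v∈N = ∈commonOut⁺ (λ u∈S → ∈commonOut⁻ v∈N (S⊆T u∈S))

  ∈⇒∉commonOut : ∀ {S w} → w ∈ S → w ∉ commonOut D S
  ∈⇒∉commonOut {w = w} w∈S w∈N with trans (sym (∈commonOut⁻ w∈N w∈S)) (loopless D w)
  ... | ()

  commonOut-∪⁅⁆-⊂ : ∀ S {w} → w ∈ commonOut D S → commonOut D (S ∪ ⁅ w ⁆) ⊂ commonOut D S
  commonOut-∪⁅⁆-⊂ S {w} w∈N =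
    commonOut-antimono {S} (p⊆p∪q ⁅ w ⁆) , w , w∈N , ∈⇒∉commonOut (q⊆p∪q S ⁅ w ⁆ (x∈⁅x⁆ w))

  CommonOutAtLeast : ℕ → ℕ → Set
  CommonOutAtLeast s m = ∀ S → ∣ S ∣ ≡ s → m ≤ ∣ commonOut D S ∣

  commonOut-nonempty : ∀ {s m} → s < n → 0 < m → CommonOutAtLeast (suc s) m →
                       ∀ S → ∣ S ∣ ≡ s → Nonempty (commonOut D S)
  commonOut-nonempty {s} s<n 0<m bound S ∣S∣≡s
    with ∣p∣<n⇒∃∉ S (subst (_< n) (sym ∣S∣≡s) s<n)
  ... | v , v∉S = 0<∣p∣⇒Nonempty _ (≤-trans 0<m (≤-trans (bound (S ∪ ⁅ v ⁆) ∣S∪v∣≡1+s) ⊆-size))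
    where
    ∣S∪v∣≡1+s : ∣ S ∪ ⁅ v ⁆ ∣ ≡ suc s
    ∣S∪v∣≡1+s = trans (∣p∪⁅x⁆∣≡1+∣p∣ S v∉S) (cong suc ∣S∣≡s)
    ⊆-size : ∣ commonOut D (S ∪ ⁅ v ⁆) ∣ ≤ ∣ commonOut D S ∣
    ⊆-size = p⊆q⇒∣p∣≤∣q∣ (commonOut-antimono {S} (p⊆p∪q ⁅ v ⁆))

  commonOutAtLeast-step : ∀ {s m} → s < n → 0 < m →
                          CommonOutAtLeast (suc s) m → CommonOutAtLeast s (suc m)
  commonOutAtLeast-step {s} s<n 0<m bound S ∣S∣≡s
    with commonOut-nonempty s<n 0<m bound S ∣S∣≡s
  ... | w , w∈N = ≤-trans (s≤s (bound (S ∪ ⁅ w ⁆) ∣S∪w∣≡1+s)) (p⊂q⇒∣p∣<∣q∣ (commonOut-∪⁅⁆-⊂ S w∈N))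
    where
    ∣S∪w∣≡1+s : ∣ S ∪ ⁅ w ⁆ ∣ ≡ suc s
    ∣S∪w∣≡1+s = trans (∣p∪⁅x⁆∣≡1+∣p∣ S (λ w∈S → ∈⇒∉commonOut w∈S w∈N)) (cong suc ∣S∣≡s)

  liking⇒commonOutAtLeast : ∀ {t l} → 0 < l → IsLiking t l D →
                            ∀ d → d ≤ t → CommonOutAtLeast (t ∸ d) (l + d)
  liking⇒commonOutAtLeast {l = l} _ (_ , liking) zero _ S ∣S∣≡t =
    ≤-reflexive (trans (+-identityʳ l) (sym (liking S ∣S∣≡t)))
  liking⇒commonOutAtLeast {t} {l} 0<l liking (suc d) 1+d≤t =
    subst (CommonOutAtLeast (t ∸ suc d)) (sym (+-suc l d))
      (commonOutAtLeast-step t∸[1+d]<n (≤-trans 0<l (m≤m+n l d))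
        (subst (λ s → CommonOutAtLeast s (l + d)) t∸d≡1+[t∸[1+d]]
          (liking⇒commonOutAtLeast 0<l liking d (<⇒≤ 1+d≤t))))
    where
    t∸d≡1+[t∸[1+d]] : t ∸ d ≡ suc (t ∸ suc d)
    t∸d≡1+[t∸[1+d]] = +-∸-assoc 1 1+d≤t
    t∸[1+d]<n : t ∸ suc d < n
    t∸[1+d]<n = ≤-trans (∸-monoʳ-< {t} z<s 1+d≤t) (proj₁ liking)

proposition2p4 : (t l : ℕ) → 1 ≤ t → 1 ≤ l →
    (n : ℕ) (D : Digraph n) → IsLiking t l D →
    (i : ℕ) → 1 ≤ i → i < t →
    (S : Subset n) → ∣ S ∣ ≡ t ∸ i → l + i ≤ ∣ commonOut D S ∣
proposition2p4 t l _ 1≤l n D liking i _ i<t =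
  liking⇒commonOutAtLeast D 1≤l liking i (<⇒≤ i<t)
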